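{- Let $Y$ be a permutation class and $\pi$ any permutation. Let $\pi=\lambda[\lambda_1,\lambda_2,\dots,\lambda_\ell]$ be the left-greedy $Y$-profile decomposition of $\pi$. Then $\lambda=\pi^Y$, the $Y$-profile of $\pi$.
   Context: Permutations of length $n$ are sequences of $1,\dots,n$; $\sigma$ is involved in $\pi$ if some subsequence of $\pi$ is order isomorphic to $\sigma$. A permutation class is a set of permutations closed downward under involvement. An interval (block) of $\pi$ is a segment of consecutive positions $\pi(i)\pi(i+1)\cdots\pi(i+j)$ whose set of values is a set of consecutive integers. For $\sigma\in S_m$ and nonempty $\alpha_1,\dots,\alpha_m$, the inflation $\sigma[\alpha_1,\dots,\alpha_m]$ replaces each entry $\sigma(i)$ by an interval order isomorphic to $\alpha_i$, the intervals being arranged as the entries of $\sigma$. A $Y$-deflation of $\pi$ is any $\pi'$ with $\pi=\pi'[\alpha_1,\dots,\alpha_k]$, all $\alpha_i\in Y$; the shortest such is unique and is the $Y$-profile $\pi^Y$. The left-greedy $Y$-profile decomposition of $\pi$ is the decomposition $\pi=\lambda[\lambda_1,\dots,\lambda_\ell]$ with every $\lambda_i\in Y$ (the $\lambda_i$ corresponding to consecutive segments of positions of $\pi$ from left to right) obtained by choosing the block $\lambda_1$ (starting at the first position) as long as possible, then the block $\lambda_2$ (starting right after $\lambda_1$) as long as possible, and so on. -}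

module Defs where

open import Data.Nat using (ℕ; _+_; _<_; _<ᵇ_; _≤_)
open import Data.Bool using (if_then_else_)
open import Data.List using (List; []; _∷_; length; upTo; map; concat; zip; _++_; lookup)
open import Data.Nat.ListAction using (sum)
open import Data.List.Relation.Binary.Permutation.Propositional using (_↭_)
open import Data.List.Relation.Binary.Sublist.Propositional using (_⊆_)
open import Data.List.Relation.Unary.All using (All)
open import Data.Fin using (Fin; cast)
open import Data.Product using (Σ; ∃; _×_; _,_; proj₁; proj₂)
open import Data.Unit using (⊤)
open import Function.Bundles using (_⇔_)
open import Relation.Nullary using (¬_)
open import Relation.Binary.PropositionalEquality using (_≡_; _≢_)

-- Convention: a permutation of length n is a list containing each of
-- 0,1,…,n-1 exactly once (0-based values instead of 1,…,n).
IsPerm : List ℕ → Set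
IsPerm xs = xs ↭ upTo (length xs)

OrderIso : List ℕ → List ℕ → Set
OrderIso xs ys =
  Σ (length xs ≡ length ys) λ e →
    ∀ (i j : Fin (length xs)) →
      (lookup xs i < lookup xs j) ⇔ (lookup ys (cast e i) < lookup ys (cast e j))

_≼_ : List ℕ → List ℕ → Set
σ ≼ π = ∃ λ τ → (τ ⊆ π) × OrderIso σ τ

record IsPermClass (Y : List ℕ → Set) : Set where
  field
    perms  : ∀ ρ → Y ρ → IsPerm ρ
    closed : ∀ σ π → Y π → IsPerm σ → σ ≼ π → Y σ

NonEmpty : List ℕ → Set
NonEmpty xs = xs ≢ []

-- Inflation σ[α₁,…,αₘ]: the block for σ(i) is αᵢ shifted up by the total size
-- of the blocks αⱼ with σ(j) < σ(i).
offset : List ℕ → List (List ℕ) → ℕ → ℕ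
offset σ αs s = sum (map (λ p → if proj₁ p <ᵇ s then length (proj₂ p) else 0) (zip σ αs))

blocks : List ℕ → List (List ℕ) → List (List ℕ)
blocks σ αs = map (λ p → map (offset σ αs (proj₁ p) +_) (proj₂ p)) (zip σ αs)

inflate : List ℕ → List (List ℕ) → List ℕ
inflate σ αs = concat (blocks σ αs)

IsDeflation : (List ℕ → Set) → List ℕ → List ℕ → Set
IsDeflation Y π π' =
  IsPerm π' × Σ (List (List ℕ)) λ αs →
    (length αs ≡ length π') × All (λ α → NonEmpty α × Y α) αs × (π ≡ inflate π' αs)

IsProfile : (List ℕ → Set) → List ℕ → List ℕ → Set
IsProfile Y π ρ = IsDeflation Y π ρ × (∀ π' → IsDeflation Y π π' → length ρ ≤ length π')

-- a segment w of values is an interval order isomorphic to some nonempty ρ ∈ Y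
-- (ρ a permutation of 0..k-1, so w = ρ shifted by c has consecutive values)
IsYBlock : (List ℕ → Set) → List ℕ → Set
IsYBlock Y w = ∃ λ ρ → NonEmpty ρ × Y ρ × ∃ λ c → w ≡ map (c +_) ρ

-- each block is as long as possible: no strictly longer segment starting at
-- the same position (extending into the rest of π) is a Y-block
Greedy : (List ℕ → Set) → List (List ℕ) → Set
Greedy Y [] = ⊤
Greedy Y (s ∷ ss) =
  (∀ p q → NonEmpty p → p ++ q ≡ concat ss → ¬ IsYBlock Y (s ++ p)) × Greedy Y ss

IsLeftGreedy : (List ℕ → Set) → List ℕ → List ℕ → List (List ℕ) → Set
IsLeftGreedy Y π λ' λs =
  IsPerm λ' × (length λs ≡ length λ') × All (λ α → NonEmpty α × Y α) λs
  × (π ≡ inflate λ' λs) × Greedy Y (blocks λ' λs)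

-- Greedy stays ahead. Compare the left-greedy blocks with the blocks of any Y-deflation
-- of π, both being consecutive segments of π. When a deflation block o starts inside a
-- greedy block g and reaches past its end, the part z of o beyond g is the difference of
-- the overlapping intervals g and o, hence itself an interval; as a subsequence of o it is
-- order isomorphic to a pattern of a permutation in Y, so z is a Y-block since Y is a
-- class. By maximality the next greedy block, which starts with z, ends no earlier than o.
-- Thus the i-th greedy block ends no earlier than the i-th deflation block, and there are
-- at most as many greedy blocks as deflation blocks.
module Submission where

open import Defs
open import Data.Nat using (ℕ; _+_; _∸_; _<_; _≤_; z≤n; s≤s)
open import Data.Nat.Properties
open import Data.List using (List; []; _∷_; length; upTo; map; concat; zip; _++_; lookup)
open import Data.List.Properties
  using (length-map; length-zipWith; length-upTo; ++-assoc; ++-conicalˡ; ∷-injective; map-∘; map-id-local)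
open import Data.List.Relation.Unary.All as All using (All; []; _∷_)
import Data.List.Relation.Unary.All.Properties as AllP
open import Data.List.Relation.Unary.Any using (here; there)
open import Data.List.Relation.Unary.AllPairs using ([]; _∷_)
open import Data.List.Relation.Unary.Unique.Propositional using (Unique)
import Data.List.Relation.Unary.Unique.Propositional.Properties as Unique
import Data.List.Relation.Binary.Permutation.Setoid.Properties as PermutationSetoid
open import Data.List.Relation.Binary.Permutation.Propositional using (_↭_; ↭-sym; ↭⇒↭ₛ)
open import Data.List.Relation.Binary.Permutation.Propositional.Properties using (∈-resp-↭; ↭-length)
open import Data.List.Relation.Binary.BagAndSetEquality using (∼bag⇒↭)
open import Data.List.Relation.Binary.Disjoint.Propositional using (Disjoint)
open import Data.List.Relation.Binary.Sublist.Propositional using (_⊆_; []; _∷_; _∷ʳ_; ⊆-refl)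
open import Data.List.Relation.Binary.Sublist.Propositional.Properties using (All-resp-⊆; ++⁺ˡ; ++⁺ʳ; ++⁺; map⁺)
open import Data.List.Membership.Propositional using (_∈_)
open import Data.List.Membership.Propositional.Properties using (∈-map⁺; ∈-map⁻; ∈-++⁺ʳ; ∈-++⁻; ∈-upTo⁺; ∈-upTo⁻; ∈-lookup)
open import Data.List.Membership.Propositional.Properties.WithK using (unique∧set⇒bag)
open import Data.Fin as Fin using (Fin; cast)
open import Data.Fin.Properties using (cast-trans)
open import Data.Product using (∃; ∃₂; _×_; _,_; proj₁; proj₂)
open import Data.Sum using (_⊎_; inj₁; inj₂)
open import Data.Empty using (⊥-elim)
open import Function using (_∘_)
open import Function.Bundles using (_⇔_; mk⇔; Equivalence)
open import Function.Construct.Composition using (_⇔-∘_)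
open import Function.Construct.Symmetry using (⇔-sym)
open import Relation.Nullary using (¬_; yes; no)
open import Relation.Binary.PropositionalEquality using (_≡_; refl; sym; trans; cong; subst; subst₂)
import Relation.Binary.PropositionalEquality.Properties as ≡

open Equivalence using (to; from)

Unique-resp-⊇ : ∀ {A : Set} {xs ys : List A} → xs ⊆ ys → Unique ys → Unique xs
Unique-resp-⊇ [] [] = []
Unique-resp-⊇ (y ∷ʳ τ) (_ ∷ u) = Unique-resp-⊇ τ u
Unique-resp-⊇ (refl ∷ τ) (px ∷ u) = All-resp-⊆ τ px ∷ Unique-resp-⊇ τ u

Unique-++⁻ʳ : ∀ {A : Set} (xs : List A) {ys} → Unique (xs ++ ys) → Unique ys
Unique-++⁻ʳ xs = Unique-resp-⊇ (++⁺ˡ xs ⊆-refl)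

Unique-++⇒Disjoint : ∀ {A : Set} (xs : List A) {ys} → Unique (xs ++ ys) → Disjoint xs ys
Unique-++⇒Disjoint (x ∷ xs) (x∉ ∷ u) (here refl , v∈ys) = All.lookup x∉ (∈-++⁺ʳ xs v∈ys) refl
Unique-++⇒Disjoint (x ∷ xs) (_ ∷ u) (there v∈xs , v∈ys) = Unique-++⇒Disjoint xs u (v∈xs , v∈ys)

++-≡-++-cases : ∀ (xs xs′ ys ys′ : List ℕ) → xs ++ xs′ ≡ ys ++ ys′ →
  (∃ λ p → NonEmpty p × ys ≡ xs ++ p × xs′ ≡ p ++ ys′) ⊎ (∃ λ p → xs ≡ ys ++ p × ys′ ≡ p ++ xs′)
++-≡-++-cases [] xs′ [] ys′ eq = inj₂ ([] , refl , sym eq)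
++-≡-++-cases [] xs′ (y ∷ ys) ys′ eq = inj₁ (y ∷ ys , (λ ()) , refl , eq)
++-≡-++-cases (x ∷ xs) xs′ [] ys′ eq = inj₂ (x ∷ xs , refl , sym eq)
++-≡-++-cases (x ∷ xs) xs′ (y ∷ ys) ys′ eq with ∷-injective eq
... | refl , eq′ with ++-≡-++-cases xs xs′ ys ys′ eq′
...   | inj₁ (p , p≢[] , ys≡ , xs′≡) = inj₁ (p , p≢[] , cong (x ∷_) ys≡ , xs′≡)
...   | inj₂ (p , xs≡ , ys′≡) = inj₂ (p , cong (x ∷_) xs≡ , ys′≡)

_∈[_,_⟩ : ℕ → ℕ → ℕ → Set
v ∈[ a , b ⟩ = a ≤ v × v < b

IsInterval : List ℕ → Set
IsInterval w = ∃₂ λ a b → ∀ v → v ∈ w ⇔ v ∈[ a , b ⟩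

interval-difference : ∀ {a A b B x y} → x ∈[ a , A ⟩ → x ∈[ b , B ⟩ → y ∈[ a , A ⟩ → ¬ y ∈[ b , B ⟩ →
  ∃₂ λ c C → ∀ v → (v ∈[ b , B ⟩ × ¬ v ∈[ a , A ⟩) ⇔ v ∈[ c , C ⟩
interval-difference {a} {A} {b} {B} (a≤x , x<A) (b≤x , x<B) (a≤y , y<A) y∉J with a ≤? b
... | yes a≤b = A , B , λ v → mk⇔
  (λ ((b≤v , v<B) , v∉I) → ≮⇒≥ (λ v<A → v∉I (≤-trans a≤b b≤v , v<A)) , v<B)
  (λ (A≤v , v<B) → (≤-trans b≤x (<⇒≤ (<-≤-trans x<A A≤v)) , v<B) , λ (_ , v<A) → <⇒≱ v<A A≤v)
... | no a≰b = b , a , λ v → mk⇔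
  (λ ((b≤v , v<B) , v∉I) → b≤v , ≰⇒> λ a≤v →
    y∉J (<⇒≤ (<-≤-trans (≰⇒> a≰b) a≤y) , <-≤-trans y<A (≤-trans (≮⇒≥ (v∉I ∘ (a≤v ,_))) (<⇒≤ v<B))))
  (λ (b≤v , v<a) → (b≤v , <-≤-trans v<a (<⇒≤ (≤-<-trans a≤x x<B))) , λ (a≤v , _) → <⇒≱ v<a a≤v)

interval-suffix : ∀ (y x z : List ℕ) → NonEmpty y → NonEmpty x → Unique (y ++ x ++ z) →
  IsInterval (y ++ x) → IsInterval (x ++ z) → IsInterval z
interval-suffix [] _ _ y≢[] _ _ _ _ = ⊥-elim (y≢[] refl)
interval-suffix _ [] _ _ x≢[] _ _ _ = ⊥-elim (x≢[] refl)
interval-suffix y@(y₀ ∷ _) x@(x₀ ∷ _) z _ _ u (a , A , I) (b , B , J)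
  with interval-difference (to (I x₀) (∈-++⁺ʳ y (here refl))) (to (J x₀) (here refl))
                           (to (I y₀) (here refl)) (λ y₀∈J → Unique-++⇒Disjoint y u (here refl , from (J y₀) y₀∈J))
... | c , C , difference = c , C , λ v → mk⇔
  (λ v∈z → to (difference v) (to (J v) (∈-++⁺ʳ x v∈z) , λ v∈I → outside-y++x v∈z (from (I v) v∈I)))
  (λ v∈K → let (v∈J , v∉I) = from (difference v) v∈K in inside-z (from (J v) v∈J) (v∉I ∘ to (I v)))
  where
  outside-y++x : ∀ {v} → v ∈ z → ¬ v ∈ y ++ x
  outside-y++x v∈z v∈y++x with ∈-++⁻ y v∈y++x
  ... | inj₁ v∈y = Unique-++⇒Disjoint y u (v∈y , ∈-++⁺ʳ x v∈z)
  ... | inj₂ v∈x = Unique-++⇒Disjoint x (Unique-++⁻ʳ y u) (v∈x , v∈z)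
  inside-z : ∀ {v} → v ∈ x ++ z → ¬ v ∈ y ++ x → v ∈ z
  inside-z v∈x++z v∉y++x with ∈-++⁻ x v∈x++z
  ... | inj₁ v∈x = ⊥-elim (v∉y++x (∈-++⁺ʳ y v∈x))
  ... | inj₂ v∈z = v∈z

IsPerm⇒Unique : ∀ {ρ} → IsPerm ρ → Unique ρ
IsPerm⇒Unique {ρ} ρ↭ = PermutationSetoid.Unique-resp-↭ (≡.setoid ℕ) (↭⇒↭ₛ (↭-sym ρ↭)) (Unique.upTo⁺ (length ρ))

IsPerm⇒∈⇔< : ∀ {ρ} → IsPerm ρ → ∀ v → v ∈ ρ ⇔ v < length ρ
IsPerm⇒∈⇔< ρ↭ v = mk⇔ (∈-upTo⁻ ∘ ∈-resp-↭ ρ↭) (∈-resp-↭ (↭-sym ρ↭) ∘ ∈-upTo⁺)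

Unique∧∈⇔<⇒IsPerm : ∀ {ρ m} → Unique ρ → (∀ v → v ∈ ρ ⇔ v < m) → IsPerm ρ
Unique∧∈⇔<⇒IsPerm {ρ} {m} u members = subst (λ n → ρ ↭ upTo n) m≡length ρ↭upTo
  where
  ρ↭upTo : ρ ↭ upTo m
  ρ↭upTo = ∼bag⇒↭ (unique∧set⇒bag u (Unique.upTo⁺ m)
    (λ {v} → mk⇔ (∈-upTo⁺ ∘ to (members v)) (from (members v) ∘ ∈-upTo⁻)))
  m≡length : m ≡ length ρ
  m≡length = trans (sym (length-upTo m)) (sym (↭-length ρ↭upTo))

v<b∸a⇒a+v<b : ∀ {a b v} → v < b ∸ a → a + v < b
v<b∸a⇒a+v<b {a} {b} {v} v<b∸a with a ≤? b
... | yes a≤b = subst (a + v <_) (m+[n∸m]≡n a≤b) (+-monoʳ-< a v<b∸a)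
... | no a≰b = ⊥-elim (n≮0 (subst (v <_) (m≤n⇒m∸n≡0 (<⇒≤ (≰⇒> a≰b))) v<b∸a))

shift-IsInterval : ∀ {ρ} → IsPerm ρ → ∀ c → IsInterval (map (c +_) ρ)
shift-IsInterval {ρ} ρ↭ c = c , c + length ρ , λ v → mk⇔ to′ (from′ v)
  where
  to′ : ∀ {v} → v ∈ map (c +_) ρ → v ∈[ c , c + length ρ ⟩
  to′ v∈ with ∈-map⁻ (c +_) v∈
  ... | u , u∈ρ , refl = m≤m+n c u , +-monoʳ-< c (to (IsPerm⇒∈⇔< ρ↭ u) u∈ρ)
  from′ : ∀ v → v ∈[ c , c + length ρ ⟩ → v ∈ map (c +_) ρ
  from′ v (c≤v , v<) = subst (_∈ map (c +_) ρ) (m+[n∸m]≡n c≤v)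
    (∈-map⁺ (c +_) (from (IsPerm⇒∈⇔< ρ↭ (v ∸ c)) (subst (v ∸ c <_) (m+n∸m≡n c (length ρ)) (∸-monoˡ-< v< c≤v))))

lookup-map : ∀ {A B : Set} (f : A → B) xs i → lookup (map f xs) i ≡ f (lookup xs (cast (length-map f xs) i))
lookup-map f (x ∷ xs) Fin.zero = refl
lookup-map f (x ∷ xs) (Fin.suc i) = lookup-map f xs i

OrderIso-map : ∀ (f g : ℕ → ℕ) (z : List ℕ) →
  (∀ {u v} → u ∈ z → v ∈ z → f u < f v ⇔ g u < g v) → OrderIso (map f z) (map g z)
OrderIso-map f g z same-order = lengths , λ i j → mk⇔ (to (order i j)) (from (order i j))
  where
  lengths : length (map f z) ≡ length (map g z)
  lengths = trans (length-map f z) (sym (length-map g z))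
  order : ∀ i j → (lookup (map f z) i < lookup (map f z) j) ⇔
                  (lookup (map g z) (cast lengths i) < lookup (map g z) (cast lengths j))
  order i j
    rewrite lookup-map f z i | lookup-map f z j
          | lookup-map g z (cast lengths i) | lookup-map g z (cast lengths j)
          | cast-trans lengths (length-map g z) i | cast-trans lengths (length-map g z) j
    = same-order (∈-lookup _) (∈-lookup _)

∸-<-∸⇔< : ∀ {a u v} → a ≤ u → u ∸ a < v ∸ a ⇔ u < v
∸-<-∸⇔< {a} {u} {v} a≤u = mk⇔ cancel (λ u<v → ∸-monoˡ-< u<v a≤u)
  where
  cancel : u ∸ a < v ∸ a → u < v
  cancel lt with u <? v
  ... | yes u<v = u<v
  ... | no u≮v = ⊥-elim (<⇒≱ lt (∸-monoˡ-≤ a (≮⇒≥ u≮v)))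

map-NonEmpty : ∀ (f : ℕ → ℕ) {xs} → NonEmpty xs → NonEmpty (map f xs)
map-NonEmpty f {[]} xs≢[] _ = xs≢[] refl
map-NonEmpty f {_ ∷ _} _ ()

module _ {Y : List ℕ → Set} (cls : IsPermClass Y) where
  open IsPermClass cls

  IsYBlock⇒NonEmpty : ∀ {w} → IsYBlock Y w → NonEmpty w
  IsYBlock⇒NonEmpty (ρ , ρ≢[] , _ , c , refl) = map-NonEmpty (c +_) ρ≢[]

  IsYBlock⇒IsInterval : ∀ {w} → IsYBlock Y w → IsInterval w
  IsYBlock⇒IsInterval (ρ , _ , Yρ , c , refl) = shift-IsInterval (perms ρ Yρ) c

  IsYBlock⇒Unique : ∀ {w} → IsYBlock Y w → Unique w
  IsYBlock⇒Unique (ρ , _ , Yρ , c , refl) = Unique.map⁺ (+-cancelˡ-≡ c _ _) (IsPerm⇒Unique (perms ρ Yρ))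

  IsYBlock-⊆ : ∀ {w z} → IsYBlock Y w → z ⊆ w → NonEmpty z → IsInterval z → IsYBlock Y z
  IsYBlock-⊆ {z = z} wY@(α , _ , Yα , c , refl) z⊆w z≢[] (a , b , z-members) =
    ρ , map-NonEmpty (_∸ a) z≢[] , closed ρ α Yα ρ-perm (map (_∸ c) z , z⊆α , order-iso) , a , z≡a+ρ
    where
    ρ : List ℕ
    ρ = map (_∸ a) z
    a≤z : All (a ≤_) z
    a≤z = All.tabulate (proj₁ ∘ to (z-members _))
    c≤z : All (c ≤_) z
    c≤z = All-resp-⊆ z⊆w (AllP.map⁺ (All.universal (m≤m+n c) α))
    z≡a+ρ : z ≡ map (a +_) ρ
    z≡a+ρ = sym (trans (sym (map-∘ z)) (map-id-local (All.map m+[n∸m]≡n a≤z)))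
    members : ∀ v → v ∈ ρ ⇔ v < b ∸ a
    members v = mk⇔ below (λ v< → subst (_∈ ρ) (m+n∸m≡n a v)
      (∈-map⁺ (_∸ a) (from (z-members (a + v)) (m≤m+n a v , v<b∸a⇒a+v<b v<))))
      where
      below : v ∈ ρ → v < b ∸ a
      below v∈ρ with ∈-map⁻ (_∸ a) v∈ρ
      ... | u , u∈z , refl = let (a≤u , u<b) = to (z-members u) u∈z in ∸-monoˡ-< u<b a≤u
    ρ-perm : IsPerm ρ
    ρ-perm = Unique∧∈⇔<⇒IsPerm
      (Unique.map⁻ (subst Unique z≡a+ρ (Unique-resp-⊇ z⊆w (IsYBlock⇒Unique wY)))) members
    z⊆α : map (_∸ c) z ⊆ α
    z⊆α = subst (map (_∸ c) z ⊆_) (trans (sym (map-∘ α)) (map-id-local (All.universal (m+n∸m≡n c) α)))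
                (map⁺ (_∸ c) z⊆w)
    order-iso : OrderIso ρ (map (_∸ c) z)
    order-iso = OrderIso-map (_∸ a) (_∸ c) z λ u∈z _ →
      ⇔-sym (∸-<-∸⇔< (All.lookup c≤z u∈z)) ⇔-∘ ∸-<-∸⇔< (All.lookup a≤z u∈z)

  -- In greedy-length-≤-ahead the current greedy block is y ++ x, of which the
  -- deflation blocks preceding os cover exactly y.
  mutual
    greedy-length-≤ : ∀ gs os → All (IsYBlock Y) gs → Greedy Y gs → All (IsYBlock Y) os →
      concat gs ≡ concat os → Unique (concat os) → length gs ≤ length os
    greedy-length-≤ [] os _ _ _ _ _ = z≤n
    greedy-length-≤ (g ∷ gs) [] (gY ∷ _) _ _ g++gs≡[] _ =
      ⊥-elim (IsYBlock⇒NonEmpty gY (++-conicalˡ g (concat gs) g++gs≡[]))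
    greedy-length-≤ (g ∷ gs) (o ∷ os) (gY ∷ gsY) (maximal , greedy) (oY ∷ osY) eq u
      with ++-≡-++-cases g (concat gs) o (concat os) eq
    ... | inj₁ (p , p≢[] , o≡g++p , gs≡p++os) =
      ⊥-elim (maximal p (concat os) p≢[] (sym gs≡p++os) (subst (IsYBlock Y) o≡g++p oY))
    ... | inj₂ (x , g≡o++x , os≡x++gs) =
      s≤s (greedy-length-≤-ahead o x gs os (IsYBlock⇒NonEmpty oY)
        (subst IsInterval g≡o++x (IsYBlock⇒IsInterval gY)) gsY greedy osY (sym os≡x++gs) u)

    greedy-length-≤-ahead : ∀ y x gs os → NonEmpty y → IsInterval (y ++ x) →
      All (IsYBlock Y) gs → Greedy Y gs → All (IsYBlock Y) os →
      x ++ concat gs ≡ concat os → Unique (y ++ concat os) → length gs ≤ length os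
    greedy-length-≤-ahead y [] gs os _ _ gsY greedy osY eq u =
      greedy-length-≤ gs os gsY greedy osY eq (Unique-++⁻ʳ y u)
    greedy-length-≤-ahead y (_ ∷ _) gs [] _ _ _ _ _ () _
    greedy-length-≤-ahead y x@(_ ∷ _) gs (o ∷ os) y≢[] y++x-interval gsY greedy (oY ∷ osY) eq u
      with ++-≡-++-cases x (concat gs) o (concat os) eq
    ... | inj₁ (z , z≢[] , refl , gs≡z++os) =
      greedy-length-≤ gs (z ∷ os) gsY greedy (zY ∷ osY) gs≡z++os (Unique-++⁻ʳ x (Unique-++⁻ʳ y u′))
      where
      u′ : Unique (y ++ x ++ z ++ concat os)
      u′ = subst (λ w → Unique (y ++ w)) (++-assoc x z (concat os)) u
      zY : IsYBlock Y z
      zY = IsYBlock-⊆ oY (++⁺ˡ x ⊆-refl) z≢[]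
        (interval-suffix y x z y≢[] (λ ()) (Unique-resp-⊇ (++⁺ (⊆-refl {x = y}) (++⁺ʳ (concat os) (⊆-refl {x = x ++ z}))) u)
          y++x-interval (IsYBlock⇒IsInterval oY))
    ... | inj₂ (p , x≡o++p , os≡p++gs) =
      m≤n⇒m≤1+n (greedy-length-≤-ahead (y ++ o) p gs os (y≢[] ∘ ++-conicalˡ y o)
        (subst IsInterval (trans (cong (y ++_) x≡o++p) (sym (++-assoc y o p))) y++x-interval)
        gsY greedy osY (sym os≡p++gs) (subst Unique (sym (++-assoc y o (concat os))) u))

All-blocks : ∀ {Y : List ℕ → Set} σ αs → All (λ α → NonEmpty α × Y α) αs → All (IsYBlock Y) (blocks σ αs)
All-blocks {Y} σ αs = shifted (offset σ αs) σ αs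
  where
  shifted : ∀ (h : ℕ → ℕ) σ αs → All (λ α → NonEmpty α × Y α) αs →
    All (IsYBlock Y) (map (λ p → map (h (proj₁ p) +_) (proj₂ p)) (zip σ αs))
  shifted h [] _ _ = []
  shifted h (_ ∷ _) [] [] = []
  shifted h (s ∷ σ) (α ∷ αs) ((α≢[] , Yα) ∷ αsY) = (α , α≢[] , Yα , h s , refl) ∷ shifted h σ αs αsY

length-blocks : ∀ σ αs → length αs ≡ length σ → length (blocks σ αs) ≡ length σ
length-blocks σ αs lengths =
  trans (length-map _ (zip σ αs)) (trans (length-zipWith _,_ σ αs) (m≤n⇒m⊓n≡m (≤-reflexive (sym lengths))))

lemma3p3 : (Y : List ℕ → Set) → IsPermClass Y → (π : List ℕ) → IsPerm π →
    (λ' : List ℕ) (λs : List (List ℕ)) → IsLeftGreedy Y π λ' λs → IsProfile Y π λ'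
lemma3p3 Y cls π π-perm λ' λs (λ'-perm , λs-length , λsY , π≡λ'[λs] , greedy) =
  (λ'-perm , λs , λs-length , λsY , π≡λ'[λs]) , minimal
  where
  minimal : ∀ π' → IsDeflation Y π π' → length λ' ≤ length π'
  minimal π' (_ , αs , αs-length , αsY , π≡π'[αs]) =
    subst₂ _≤_ (length-blocks λ' λs λs-length) (length-blocks π' αs αs-length)
      (greedy-length-≤ cls (blocks λ' λs) (blocks π' αs) (All-blocks λ' λs λsY) greedy (All-blocks π' αs αsY)
        (trans (sym π≡λ'[λs]) π≡π'[αs]) (subst Unique π≡π'[αs] (IsPerm⇒Unique π-perm)))
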